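{- Let $G\mathcal{B}$ be the Gentzen calculus described in the context. Then every sequent is equivalent in $G\mathcal{B}$ to a finite set of atomic sequents, and every finite set of sequents is equivalent in $G\mathcal{B}$ to a single sequent of the form $\emptyset \vartriangleright \varphi$.
   Context: Formulas are built from a set of propositional atoms using the binary connectives $\wedge,\vee$, the unary connective ${ - }$ (De Morgan negation) and the constants $\top,\bot$. A sequent $\Gamma \vartriangleright \Delta$ is a pair of finite multisets of formulas; it is atomic if all formulas in it are atoms; $\emptyset\vartriangleright\emptyset$ is the empty sequent. Rules are schemata applied in all substitution instances ($\varphi,\psi$ range over formulas, $\Gamma,\Delta$ over finite multisets of formulas). The calculus $G\mathcal{B}$ consists of: Introduction rules: from $\Gamma\vartriangleright\Delta,\varphi$ and $\Gamma\vartriangleright\Delta,\psi$ infer $\Gamma\vartriangleright\Delta,\varphi\wedge\psi$; from $\varphi,\psi,\Gamma\vartriangleright\Delta$ infer $\varphi\wedge\psi,\Gamma\vartriangleright\Delta$; from $\varphi,\Gamma\vartriangleright\Delta$ and $\psi,\Gamma\vartriangleright\Delta$ infer $\varphi\vee\psi,\Gamma\vartriangleright\Delta$; from $\Gamma\vartriangleright\Delta,\varphi,\psi$ infer $\Gamma\vartriangleright\Delta,\varphi\vee\psi$; from $\varphi,\Gamma\vartriangleright\Delta$ infer $\Gamma\vartriangleright\Delta,{ - }\varphi$; from $\Gamma\vartriangleright\Delta,\varphi$ infer ${ - }\varphi,\Gamma\vartriangleright\Delta$; the axioms $\emptyset\vartriangleright\top$ and $\bot\vartriangleright\emptyset$.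 Elimination rules (inverses): from $\Gamma\vartriangleright\Delta,\varphi\wedge\psi$ infer $\Gamma\vartriangleright\Delta,\varphi$, and also infer $\Gamma\vartriangleright\Delta,\psi$; from $\varphi\wedge\psi,\Gamma\vartriangleright\Delta$ infer $\varphi,\psi,\Gamma\vartriangleright\Delta$; from $\varphi\vee\psi,\Gamma\vartriangleright\Delta$ infer $\varphi,\Gamma\vartriangleright\Delta$, and also $\psi,\Gamma\vartriangleright\Delta$; from $\Gamma\vartriangleright\Delta,\varphi\vee\psi$ infer $\Gamma\vartriangleright\Delta,\varphi,\psi$; from $\Gamma\vartriangleright\Delta,{ - }\varphi$ infer $\varphi,\Gamma\vartriangleright\Delta$; from ${ - }\varphi,\Gamma\vartriangleright\Delta$ infer $\Gamma\vartriangleright\Delta,\varphi$; from $\top,\Gamma\vartriangleright\Delta$ infer $\Gamma\vartriangleright\Delta$; from $\Gamma\vartriangleright\Delta,\bot$ infer $\Gamma\vartriangleright\Delta$. Structural rules: Weakening (from $\Gamma\vartriangleright\Delta$ infer $\varphi,\Gamma\vartriangleright\Delta$, and infer $\Gamma\vartriangleright\Delta,\varphi$) and Contraction (from $\varphi,\varphi,\Gamma\vartriangleright\Delta$ infer $\varphi,\Gamma\vartriangleright\Delta$; from $\Gamma\vartriangleright\Delta,\varphi,\varphi$ infer $\Gamma\vartriangleright\Delta,\varphi$). A sequent is derivable from a set of sequents $S$ if it has a proof (a well-founded labelled tree built by the rules with leaves in $S$ or axioms). Two sets of sequents $S,S'$ are equivalent in $G\mathcal{B}$ if every sequent of $S'$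 is derivable from $S$ and every sequent of $S$ is derivable from $S'$ (a single sequent is identified with the singleton set). -}

module Defs where

open import Data.List using (List; []; _∷_; [_])
open import Data.List.Membership.Propositional using (_∈_)
open import Data.List.Relation.Unary.All using (All)
open import Data.List.Relation.Binary.Permutation.Propositional using (_↭_)
open import Data.Product using (_×_)

data Formula (A : Set) : Set where
  atom : A → Formula A
  _∧_  : Formula A → Formula A → Formula A
  _∨_  : Formula A → Formula A → Formula A
  -_   : Formula A → Formula A
  ⊤ ⊥  : Formula A

-- A sequent Γ ▷ Δ: pair of finite multisets, represented as lists;
-- multiset identity is recovered by the permutation rule `perm` below.
record Sequent (A : Set) : Set where
  constructor _▷_
  field
    ante : List (Formula A)
    succ : List (Formula A)
open Sequent public

data IsAtom {A : Set} : Formula A → Set where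
  isAtom : (a : A) → IsAtom (atom a)

Atomic : {A : Set} → Sequent A → Set
Atomic (Γ ▷ Δ) = All IsAtom Γ × All IsAtom Δ

-- Derivability in GB from a set of sequents S (a predicate on sequents).
-- Principal formulas are placed at the head of the lists; `perm` makes
-- sequents multisets (rules apply at any position).
data Der {A : Set} (S : Sequent A → Set) : Sequent A → Set where
  leaf  : ∀ {s} → S s → Der S s
  perm  : ∀ {Γ Γ' Δ Δ'} → Γ ↭ Γ' → Δ ↭ Δ' → Der S (Γ ▷ Δ) → Der S (Γ' ▷ Δ')
  ∧R    : ∀ {Γ Δ φ ψ} → Der S (Γ ▷ (φ ∷ Δ)) → Der S (Γ ▷ (ψ ∷ Δ)) → Der S (Γ ▷ ((φ ∧ ψ) ∷ Δ))
  ∧L    : ∀ {Γ Δ φ ψ} → Der S ((φ ∷ ψ ∷ Γ) ▷ Δ) → Der S (((φ ∧ ψ) ∷ Γ) ▷ Δ)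
  ∨L    : ∀ {Γ Δ φ ψ} → Der S ((φ ∷ Γ) ▷ Δ) → Der S ((ψ ∷ Γ) ▷ Δ) → Der S (((φ ∨ ψ) ∷ Γ) ▷ Δ)
  ∨R    : ∀ {Γ Δ φ ψ} → Der S (Γ ▷ (φ ∷ ψ ∷ Δ)) → Der S (Γ ▷ ((φ ∨ ψ) ∷ Δ))
  -R    : ∀ {Γ Δ φ} → Der S ((φ ∷ Γ) ▷ Δ) → Der S (Γ ▷ ((- φ) ∷ Δ))
  -L    : ∀ {Γ Δ φ} → Der S (Γ ▷ (φ ∷ Δ)) → Der S (((- φ) ∷ Γ) ▷ Δ)
  ⊤R    : Der S ([] ▷ [ ⊤ ])
  ⊥L    : Der S ([ ⊥ ] ▷ [])
  ∧R-e₁ : ∀ {Γ Δ φ ψ} → Der S (Γ ▷ ((φ ∧ ψ) ∷ Δ)) → Der S (Γ ▷ (φ ∷ Δ))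
  ∧R-e₂ : ∀ {Γ Δ φ ψ} → Der S (Γ ▷ ((φ ∧ ψ) ∷ Δ)) → Der S (Γ ▷ (ψ ∷ Δ))
  ∧L-e  : ∀ {Γ Δ φ ψ} → Der S (((φ ∧ ψ) ∷ Γ) ▷ Δ) → Der S ((φ ∷ ψ ∷ Γ) ▷ Δ)
  ∨L-e₁ : ∀ {Γ Δ φ ψ} → Der S (((φ ∨ ψ) ∷ Γ) ▷ Δ) → Der S ((φ ∷ Γ) ▷ Δ)
  ∨L-e₂ : ∀ {Γ Δ φ ψ} → Der S (((φ ∨ ψ) ∷ Γ) ▷ Δ) → Der S ((ψ ∷ Γ) ▷ Δ)
  ∨R-e  : ∀ {Γ Δ φ ψ} → Der S (Γ ▷ ((φ ∨ ψ) ∷ Δ)) → Der S (Γ ▷ (φ ∷ ψ ∷ Δ))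
  -R-e  : ∀ {Γ Δ φ} → Der S (Γ ▷ ((- φ) ∷ Δ)) → Der S ((φ ∷ Γ) ▷ Δ)
  -L-e  : ∀ {Γ Δ φ} → Der S (((- φ) ∷ Γ) ▷ Δ) → Der S (Γ ▷ (φ ∷ Δ))
  ⊤L-e  : ∀ {Γ Δ} → Der S ((⊤ ∷ Γ) ▷ Δ) → Der S (Γ ▷ Δ)
  ⊥R-e  : ∀ {Γ Δ} → Der S (Γ ▷ (⊥ ∷ Δ)) → Der S (Γ ▷ Δ)
  WL    : ∀ {Γ Δ φ} → Der S (Γ ▷ Δ) → Der S ((φ ∷ Γ) ▷ Δ)
  WR    : ∀ {Γ Δ φ} → Der S (Γ ▷ Δ) → Der S (Γ ▷ (φ ∷ Δ))
  CL    : ∀ {Γ Δ φ} → Der S ((φ ∷ φ ∷ Γ) ▷ Δ) → Der S ((φ ∷ Γ) ▷ Δ)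
  CR    : ∀ {Γ Δ φ} → Der S (Γ ▷ (φ ∷ φ ∷ Δ)) → Der S (Γ ▷ (φ ∷ Δ))

_⊢_ : {A : Set} → List (Sequent A) → Sequent A → Set
L ⊢ s = Der (_∈ L) s

_≋_ : {A : Set} → List (Sequent A) → List (Sequent A) → Set
L ≋ L' = All (L ⊢_) L' × All (L' ⊢_) L

-- Every rule of GB is invertible, so a sequent is interderivable with the premises
-- of the rule introducing any of its compound formulas; decomposing all formulas
-- leaves finitely many atomic sequents (⊤ on the right and ⊥ on the left produce
-- derivable sequents, which drop out). Conversely, by the rules for ∨ and -, a
-- sequent Γ ▷ Δ is interderivable with ∅ ▷ ⋁ (-Γ, Δ), and the rules for ∧ turn a
-- finite set of sequents ∅ ▷ φᵢ into the single sequent ∅ ▷ ⋀ φᵢ.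
module Submission where

open import Defs
open import Data.List using (List; []; _∷_; [_]; _++_; map)
open import Data.List.Properties using (++-identityʳ)
open import Data.List.Membership.Propositional using (_∈_)
open import Data.List.Membership.Propositional.Properties using (∈-++⁺ˡ; ∈-++⁺ʳ)
open import Data.List.Relation.Unary.All using (All; []; _∷_; lookup; tabulate) renaming (map to All-map)
open import Data.List.Relation.Unary.All.Properties using (++⁺; map⁺; map⁻)
open import Data.List.Relation.Unary.Any using (here; there)
open import Data.List.Relation.Binary.Permutation.Propositional using (_↭_; ↭-refl; ↭-sym; ↭-reflexive; swap)
open import Data.List.Relation.Binary.Permutation.Propositional.Properties using (shift; ++-comm)
open import Data.Product using (_×_; Σ; ∃; _,_)
open import Relation.Binary.PropositionalEquality using (refl; subst; cong₂)

module _ {A : Set} where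

  private
    Seq = Sequent A
    F = Formula A

    unpad : (xs : List F) → xs ++ [] ↭ xs
    unpad xs = ↭-reflexive (++-identityʳ xs)

  graft : {S T : Seq → Set} → (∀ {s} → S s → Der T s) → ∀ {s} → Der S s → Der T s
  graft f (leaf x) = f x
  graft f (perm p q d) = perm p q (graft f d)
  graft f (∧R d e) = ∧R (graft f d) (graft f e)
  graft f (∧L d) = ∧L (graft f d)
  graft f (∨L d e) = ∨L (graft f d) (graft f e)
  graft f (∨R d) = ∨R (graft f d)
  graft f (-R d) = -R (graft f d)
  graft f (-L d) = -L (graft f d)
  graft f ⊤R = ⊤R
  graft f ⊥L = ⊥L
  graft f (∧R-e₁ d) = ∧R-e₁ (graft f d)
  graft f (∧R-e₂ d) = ∧R-e₂ (graft f d)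
  graft f (∧L-e d) = ∧L-e (graft f d)
  graft f (∨L-e₁ d) = ∨L-e₁ (graft f d)
  graft f (∨L-e₂ d) = ∨L-e₂ (graft f d)
  graft f (∨R-e d) = ∨R-e (graft f d)
  graft f (-R-e d) = -R-e (graft f d)
  graft f (-L-e d) = -L-e (graft f d)
  graft f (⊤L-e d) = ⊤L-e (graft f d)
  graft f (⊥R-e d) = ⊥R-e (graft f d)
  graft f (WL d) = WL (graft f d)
  graft f (WR d) = WR (graft f d)
  graft f (CL d) = CL (graft f d)
  graft f (CR d) = CR (graft f d)

  ⊢-mono : {L M : List Seq} → (∀ {s} → s ∈ L → s ∈ M) → ∀ {s} → L ⊢ s → M ⊢ s
  ⊢-mono L⊆M = graft (λ s∈L → leaf (L⊆M s∈L))

  hyp : {s : Seq} → [ s ] ⊢ s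
  hyp = leaf (here refl)

  ≋-refl : {L : List Seq} → L ≋ L
  ≋-refl = tabulate leaf , tabulate leaf

  ≋-trans : {L M N : List Seq} → L ≋ M → M ≋ N → L ≋ N
  ≋-trans (L⊢M , M⊢L) (M⊢N , N⊢M) =
    All-map (graft (lookup L⊢M)) M⊢N , All-map (graft (lookup N⊢M)) M⊢L

  ≋-++ : {L₁ M₁ L₂ M₂ : List Seq} → L₁ ≋ M₁ → L₂ ≋ M₂ → (L₁ ++ L₂) ≋ (M₁ ++ M₂)
  ≋-++ {L₁} {M₁} (L₁⊢M₁ , M₁⊢L₁) (L₂⊢M₂ , M₂⊢L₂) =
    ++⁺ (All-map (⊢-mono ∈-++⁺ˡ) L₁⊢M₁) (All-map (⊢-mono (∈-++⁺ʳ L₁)) L₂⊢M₂) ,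
    ++⁺ (All-map (⊢-mono ∈-++⁺ˡ) M₁⊢L₁) (All-map (⊢-mono (∈-++⁺ʳ M₁)) M₂⊢L₂)

  ≋-unary : {s t : Seq} → [ s ] ⊢ t → [ t ] ⊢ s → [ s ] ≋ [ t ]
  ≋-unary s⊢t t⊢s = s⊢t ∷ [] , t⊢s ∷ []

  ≋-binary : {s t u : Seq} → [ s ] ⊢ t → [ s ] ⊢ u → (t ∷ [ u ]) ⊢ s → [ s ] ≋ (t ∷ [ u ])
  ≋-binary s⊢t s⊢u tu⊢s = s⊢t ∷ s⊢u ∷ [] , tu⊢s ∷ []

  ≋-perm : {Γ Γ' Δ Δ' : List F} → Γ ↭ Γ' → Δ ↭ Δ' → [ Γ ▷ Δ ] ≋ [ Γ' ▷ Δ' ]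
  ≋-perm p q = ≋-unary (perm p q hyp) (perm (↭-sym p) (↭-sym q) hyp)

  WL* : {S : Seq → Set} {Γ Δ : List F} → ∀ Γ' → Der S (Γ ▷ Δ) → Der S ((Γ' ++ Γ) ▷ Δ)
  WL* [] d = d
  WL* (φ ∷ Γ') d = WL (WL* Γ' d)

  WR* : {S : Seq → Set} {Γ Δ : List F} → ∀ Δ' → Der S (Γ ▷ Δ) → Der S (Γ ▷ (Δ' ++ Δ))
  WR* [] d = d
  WR* (φ ∷ Δ') d = WR (WR* Δ' d)

  ⊥L-weakened : {S : Seq → Set} → ∀ Γ Δ → Der S ((⊥ ∷ Γ) ▷ Δ)
  ⊥L-weakened Γ Δ = perm (++-comm Γ [ ⊥ ]) (unpad Δ) (WL* Γ (WR* Δ ⊥L))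

  ⊤R-weakened : {S : Seq → Set} → ∀ Γ Δ → Der S (Γ ▷ (⊤ ∷ Δ))
  ⊤R-weakened Γ Δ = perm (unpad Γ) (++-comm Δ [ ⊤ ]) (WR* Δ (WL* Γ ⊤R))

  AtomicDecomposition : Seq → Set
  AtomicDecomposition s = Σ (List Seq) (λ L → All Atomic L × ([ s ] ≋ L))

  decomposition-≋ : {s t : Seq} → [ s ] ≋ [ t ] → AtomicDecomposition t → AtomicDecomposition s
  decomposition-≋ s≋t (L , atomic , t≋L) = L , atomic , ≋-trans s≋t t≋L

  decomposition-≋₂ : {s t u : Seq} → [ s ] ≋ (t ∷ [ u ]) →
                     AtomicDecomposition t → AtomicDecomposition u → AtomicDecomposition s
  decomposition-≋₂ s≋tu (L , atomicL , t≋L) (M , atomicM , u≋M) =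
    L ++ M , ++⁺ atomicL atomicM , ≋-trans s≋tu (≋-++ t≋L u≋M)

  decomposition-derivable : {s : Seq} → [] ⊢ s → AtomicDecomposition s
  decomposition-derivable ⊢s = [] , [] , ([] , ⊢s ∷ [])

  -- The atoms already split off are kept at the end, so that the formula being
  -- decomposed stays at the head of the sequent, where the rules act.
  Decomposes : List F → List F → Set
  Decomposes Γ Δ = ∀ {Γₐ Δₐ} → All IsAtom Γₐ → All IsAtom Δₐ →
                   AtomicDecomposition ((Γ ++ Γₐ) ▷ (Δ ++ Δₐ))

  decomposes-[] : Decomposes [] []
  decomposes-[] {Γₐ} {Δₐ} atomicΓ atomicΔ = [ Γₐ ▷ Δₐ ] , (atomicΓ , atomicΔ) ∷ [] , ≋-refl

  decomposesˡ : ∀ φ {Γ Δ} → Decomposes Γ Δ → Decomposes (φ ∷ Γ) Δ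
  decomposesʳ : ∀ φ {Γ Δ} → Decomposes Γ Δ → Decomposes Γ (φ ∷ Δ)

  decomposesˡ (atom a) {Γ} h {Γₐ} atomicΓ atomicΔ =
    decomposition-≋ (≋-perm (↭-sym (shift (atom a) Γ Γₐ)) ↭-refl) (h (isAtom a ∷ atomicΓ) atomicΔ)
  decomposesˡ (φ ∧ ψ) h atomicΓ atomicΔ =
    decomposition-≋ (≋-unary (∧L-e hyp) (∧L hyp)) (decomposesˡ φ (decomposesˡ ψ h) atomicΓ atomicΔ)
  decomposesˡ (φ ∨ ψ) h atomicΓ atomicΔ =
    decomposition-≋₂ (≋-binary (∨L-e₁ hyp) (∨L-e₂ hyp) (∨L (leaf (here refl)) (leaf (there (here refl)))))
      (decomposesˡ φ h atomicΓ atomicΔ) (decomposesˡ ψ h atomicΓ atomicΔ)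
  decomposesˡ (- φ) h atomicΓ atomicΔ =
    decomposition-≋ (≋-unary (-L-e hyp) (-L hyp)) (decomposesʳ φ h atomicΓ atomicΔ)
  decomposesˡ ⊤ h atomicΓ atomicΔ =
    decomposition-≋ (≋-unary (⊤L-e hyp) (WL hyp)) (h atomicΓ atomicΔ)
  decomposesˡ ⊥ h atomicΓ atomicΔ = decomposition-derivable (⊥L-weakened _ _)

  decomposesʳ (atom a) {Δ = Δ} h {Δₐ = Δₐ} atomicΓ atomicΔ =
    decomposition-≋ (≋-perm ↭-refl (↭-sym (shift (atom a) Δ Δₐ))) (h atomicΓ (isAtom a ∷ atomicΔ))
  decomposesʳ (φ ∧ ψ) h atomicΓ atomicΔ =
    decomposition-≋₂ (≋-binary (∧R-e₁ hyp) (∧R-e₂ hyp) (∧R (leaf (here refl)) (leaf (there (here refl)))))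
      (decomposesʳ φ h atomicΓ atomicΔ) (decomposesʳ ψ h atomicΓ atomicΔ)
  decomposesʳ (φ ∨ ψ) h atomicΓ atomicΔ =
    decomposition-≋ (≋-unary (∨R-e hyp) (∨R hyp)) (decomposesʳ φ (decomposesʳ ψ h) atomicΓ atomicΔ)
  decomposesʳ (- φ) h atomicΓ atomicΔ =
    decomposition-≋ (≋-unary (-R-e hyp) (-R hyp)) (decomposesˡ φ h atomicΓ atomicΔ)
  decomposesʳ ⊤ h atomicΓ atomicΔ = decomposition-derivable (⊤R-weakened _ _)
  decomposesʳ ⊥ h atomicΓ atomicΔ =
    decomposition-≋ (≋-unary (⊥R-e hyp) (WR hyp)) (h atomicΓ atomicΔ)

  decomposes : ∀ Γ Δ → Decomposes Γ Δ
  decomposes (φ ∷ Γ) Δ = decomposesˡ φ (decomposes Γ Δ)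
  decomposes [] (ψ ∷ Δ) = decomposesʳ ψ (decomposes [] Δ)
  decomposes [] [] = decomposes-[]

  atomicDecomposition : (s : Seq) → AtomicDecomposition s
  atomicDecomposition (Γ ▷ Δ) =
    subst AtomicDecomposition (cong₂ _▷_ (++-identityʳ Γ) (++-identityʳ Δ)) (decomposes Γ Δ [] [])

  ⋁ : List F → F
  ⋁ [] = ⊥
  ⋁ (φ ∷ Φ) = φ ∨ ⋁ Φ

  ⋀ : List F → F
  ⋀ [] = ⊤
  ⋀ (φ ∷ Φ) = φ ∧ ⋀ Φ

  module _ {S : Seq → Set} where

    ⋁R : ∀ Φ {Γ Δ} → Der S (Γ ▷ (Φ ++ Δ)) → Der S (Γ ▷ (⋁ Φ ∷ Δ))
    ⋁R [] d = WR d
    ⋁R (φ ∷ Φ) {Δ = Δ} d =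
      ∨R (perm ↭-refl (swap (⋁ Φ) φ ↭-refl) (⋁R Φ (perm ↭-refl (↭-sym (shift φ Φ Δ)) d)))

    ⋁R-e : ∀ Φ {Γ Δ} → Der S (Γ ▷ (⋁ Φ ∷ Δ)) → Der S (Γ ▷ (Φ ++ Δ))
    ⋁R-e [] d = ⊥R-e d
    ⋁R-e (φ ∷ Φ) {Δ = Δ} d =
      perm ↭-refl (shift φ Φ Δ) (⋁R-e Φ (perm ↭-refl (swap φ (⋁ Φ) ↭-refl) (∨R-e d)))

    -R* : ∀ Γ₁ {Γ Δ} → Der S ((Γ₁ ++ Γ) ▷ Δ) → Der S (Γ ▷ (map -_ Γ₁ ++ Δ))
    -R* [] d = d
    -R* (γ ∷ Γ₁) {Γ} d = -R (-R* Γ₁ (perm (↭-sym (shift γ Γ₁ Γ)) ↭-refl d))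

    -R*-e : ∀ Γ₁ {Γ Δ} → Der S (Γ ▷ (map -_ Γ₁ ++ Δ)) → Der S ((Γ₁ ++ Γ) ▷ Δ)
    -R*-e [] d = d
    -R*-e (γ ∷ Γ₁) {Γ} d = perm (shift γ Γ₁ Γ) ↭-refl (-R*-e Γ₁ (-R-e d))

    ⋀R : ∀ {Γ Δ Φ} → All (λ φ → Der S (Γ ▷ (φ ∷ Δ))) Φ → Der S (Γ ▷ (⋀ Φ ∷ Δ))
    ⋀R [] = ⊤R-weakened _ _
    ⋀R (d ∷ ds) = ∧R d (⋀R ds)

    ⋀R-e : ∀ Φ {Γ Δ} → Der S (Γ ▷ (⋀ Φ ∷ Δ)) → All (λ φ → Der S (Γ ▷ (φ ∷ Δ))) Φ
    ⋀R-e [] d = []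
    ⋀R-e (φ ∷ Φ) d = ∧R-e₁ d ∷ ⋀R-e Φ (∧R-e₂ d)

  ⌜_⌝ : Seq → F
  ⌜ Γ ▷ Δ ⌝ = ⋁ (map -_ Γ ++ Δ)

  ⌜⌝R : {S : Seq → Set} {s : Seq} → Der S s → Der S ([] ▷ [ ⌜ s ⌝ ])
  ⌜⌝R {s = Γ ▷ Δ} d =
    ⋁R (map -_ Γ ++ Δ) (perm ↭-refl (↭-sym (unpad _)) (-R* Γ (perm (↭-sym (unpad Γ)) ↭-refl d)))

  ⌜⌝R-e : {S : Seq → Set} {s : Seq} → Der S ([] ▷ [ ⌜ s ⌝ ]) → Der S s
  ⌜⌝R-e {s = Γ ▷ Δ} d =
    perm (unpad Γ) ↭-refl (-R*-e Γ (perm ↭-refl (unpad _) (⋁R-e (map -_ Γ ++ Δ) d)))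

  ≋-formula : (L : List Seq) → L ≋ [ [] ▷ [ ⋀ (map ⌜_⌝ L) ] ]
  ≋-formula L =
    ⋀R (map⁺ (tabulate (λ s∈L → ⌜⌝R (leaf s∈L)))) ∷ [] ,
    All-map ⌜⌝R-e (map⁻ (⋀R-e (map ⌜_⌝ L) hyp))

proposition3p2 : {A : Set} →
    ((s : Sequent A) → Σ (List (Sequent A)) (λ L → All Atomic L × ([ s ] ≋ L)))
    × ((L : List (Sequent A)) → ∃ (λ (φ : Formula A) → L ≋ [ [] ▷ [ φ ] ]))
proposition3p2 = atomicDecomposition , λ L → ⋀ (map ⌜_⌝ L) , ≋-formula L
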